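{- Let $f_n^2$ denote the number of permutations $\pi\in\mathcal{S}_n$ with $\theta^2(\pi)=\pi$. Then for $n>9$, $$f_n^2\geq f_{n-1}^2+f_{n-2}^2+2f_{n-4}^2+2f_{n-9}^2.$$
   Context: $\mathcal{S}_n$ is the symmetric group on $[n]$, permutations in one-line notation. The standard cycle notation of $\pi$ writes each cycle (fixed points included) with its largest element first and orders cycles by increasing largest element. The fundamental bijection $\theta:\mathcal{S}_n\to\mathcal{S}_n$ maps $\pi$ to the permutation whose one-line notation is obtained by erasing the parentheses of the standard cycle notation of $\pi$; $\theta^2=\theta\circ\theta$. -}

module Defs where

open import Data.Nat using (ℕ; zero; suc; _≤?_; _≟_)
open import Data.Bool using (Bool; true; false; _∧_)
open import Data.List using (List; []; _∷_; map; concatMap; filter; length; upTo)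
import Data.List.Properties as LP
open import Data.List.Relation.Unary.Unique.DecPropositional _≟_ using (unique?)
open import Relation.Nullary.Decidable using (⌊_⌋; yes; no)
open import Data.List.Relation.Unary.All using (All)
import Data.List.Relation.Unary.All as All

range : ℕ → List ℕ
range n = map suc (upTo n)

words : List ℕ → ℕ → List (List ℕ)
words xs zero    = [] ∷ []
words xs (suc k) = concatMap (λ w → map (λ x → x ∷ w) xs) (words xs k)

-- S_n : all permutations of [n] in one-line notation
-- (words of length n over [n] with pairwise distinct entries)
S : ℕ → List (List ℕ)
S n = filter unique? (words (range n) n)

-- π(i) for a permutation in one-line notation (1-indexed; 0 if out of range)
nth : List ℕ → ℕ → ℕ
nth []       _             = 0
nth (x ∷ xs) zero          = 0
nth (x ∷ xs) (suc zero)    = x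
nth (x ∷ xs) (suc (suc i)) = nth xs (suc i)

-- rest of the cycle of π through m, starting at x, stopping when m is reached
-- (fuel bounds the number of steps; n steps always suffice in S_n)
walk : List ℕ → ℕ → ℕ → ℕ → List ℕ
walk π m zero       x = []
walk π m (suc fuel) x with x ≟ m
... | yes _ = []
... | no _ = x ∷ walk π m fuel (nth π x)

cycleFrom : List ℕ → ℕ → List ℕ
cycleFrom π m = m ∷ walk π m (length π) (nth π m)

isCycleMax : List ℕ → ℕ → Bool
isCycleMax π m = ⌊ All.all? (λ x → x ≤? m) (cycleFrom π m) ⌋

-- standard cycle notation: each cycle written with its largest element first,
-- cycles ordered by increasing largest element; θ erases the parentheses.
θ : List ℕ → List ℕ
θ π = concatMap (λ m → if isCycleMax π m then cycleFrom π m else []) (range (length π))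
  where
    if_then_else_ : {A : Set} → Bool → A → A → A
    if true  then a else b = a
    if false then a else b = b

f² : ℕ → ℕ
f² n = length (filter (λ π → LP.≡-dec _≟_ (θ (θ π)) π) (S n))

-- Write σ ⊕ τ for the permutation acting as σ on 1, …, |σ| and as τ, shifted by |σ|, on the
-- remaining points. The cycles of σ ⊕ τ are those of σ followed by the shifted cycles of τ, and
-- standard cycle notation lists them in this order, so θ (σ ⊕ τ) = θ σ ⊕ θ τ and θ² commutes
-- with ⊕. Hence for a fixed point τ of θ² of size k, σ ↦ σ ⊕ τ embeds the fixed points of θ² in
-- S_(n−k) into those in S_n, and every image π satisfies n − π(n) = k − τ(k). Six such τ, of
-- sizes 1, 2, 4, 4, 9, 9 and with distinct values of k − τ(k), have disjoint images.

module Submission where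

open import Defs
open import Data.Empty using (⊥-elim)
open import Data.Fin using (Fin; toℕ; fromℕ<)
open import Data.Fin.Properties using (toℕ-fromℕ<; toℕ<n; pigeonhole)
open import Data.List using (List; []; _∷_; _++_; map; concat; concatMap; filter; length; upTo; applyUpTo)
open import Data.List.Properties
  using ( ≡-dec; ∷-injectiveˡ; ++-cancelʳ; map-id; map-cong; map-cong-local; length-map; length-++
        ; concatMap-cong; concatMap-++; concatMap-map; map-concatMap
        ; length-applyUpTo; map-applyUpTo; map-upTo )
open import Data.List.Membership.Propositional using (_∈_; _∉_; find; lose)
open import Data.List.Membership.Propositional.Properties
  using (∈-map⁺; ∈-map⁻; ∈-concatMap⁺; ∈-concatMap⁻; ∈-filter⁺; ∈-filter⁻; ∈-upTo⁺; ∈-upTo⁻)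
open import Data.List.Extrema.Nat using (max; argmax-all; ⊥≤max; xs≤max)
open import Data.List.Relation.Binary.Subset.Propositional using (_⊆_)
open import Data.List.Relation.Unary.All as All using (All; []; _∷_)
import Data.List.Relation.Unary.All.Properties as AllP
open import Data.List.Relation.Unary.Any using (here; there)
open import Data.List.Relation.Unary.Unique.Propositional using (Unique; []; _∷_)
import Data.List.Relation.Unary.Unique.Propositional.Properties as Unique
open import Data.Nat using (ℕ; zero; suc; _+_; _*_; _∸_; _≤_; _<_; z≤n; s≤s; _≟_; _≤?_; NonZero)
open import Data.Nat.DivMod using (_/_; _%_; m≡m%n+[m/n]*n; m%n<n)
open import Data.Nat.GeneralisedArithmetic using (iterate)
open import Data.Nat.ListAction using (sum)
open import Data.Nat.Properties
open import Data.Nat.Tactic.RingSolver using (solve-∀)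
open import Data.List.Relation.Unary.Unique.DecPropositional _≟_ using (unique?)
open import Data.Product using (∃; _×_; _,_; proj₁; proj₂)
open import Relation.Nullary using (¬_; Dec; yes; no)
open import Relation.Nullary.Decidable using (_×-dec_; from-yes)
open import Function using (_∘_; id)
open import Relation.Binary.PropositionalEquality

private
  variable
    A B : Set
    x : A
    xs ys : List A

∈-remove : x ∈ ys → ∃ λ zs → length ys ≡ suc (length zs) × (∀ {y} → y ∈ ys → y ≢ x → y ∈ zs)
∈-remove {ys = _ ∷ ys} (here refl) =
  ys , refl , λ { (here refl) y≢x → ⊥-elim (y≢x refl) ; (there y∈ys) _ → y∈ys }
∈-remove {ys = z ∷ ys} (there x∈ys) with zs , eq , keep ← ∈-remove x∈ys =
  z ∷ zs , cong suc eq , λ { (here refl) _ → here refl ; (there y∈ys) y≢x → there (keep y∈ys y≢x) }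

Unique-⊆⇒length≤ : Unique xs → xs ⊆ ys → length xs ≤ length ys
Unique-⊆⇒length≤ {xs = []} _ _ = z≤n
Unique-⊆⇒length≤ {xs = x ∷ xs} (x∉xs ∷ distinct) xs⊆ys
  with zs , eq , keep ← ∈-remove (xs⊆ys (here refl)) =
  subst (suc (length xs) ≤_) (sym eq) (s≤s (Unique-⊆⇒length≤ distinct λ y∈xs →
    keep (xs⊆ys (there y∈xs)) λ y≡x → All.lookup x∉xs y∈xs (sym y≡x)))

concatMap-unique : ∀ {K : Set} (label : A → K) (f : A → List B) {xs} → Unique (map label xs) →
  (∀ {x} → x ∈ xs → Unique (f x)) →
  (∀ {x x′ y} → x ∈ xs → x′ ∈ xs → y ∈ f x → y ∈ f x′ → label x ≡ label x′) →
  Unique (concatMap f xs)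
concatMap-unique label f {[]} _ _ _ = []
concatMap-unique label f {x ∷ xs} (fresh ∷ distinct) unique-f shared =
  Unique.++⁺ (unique-f (here refl))
    (concatMap-unique label f distinct (unique-f ∘ there) λ p q → shared (there p) (there q))
    λ (y∈fx , y∈rest) → let x′ , x′∈xs , y∈fx′ = find (∈-concatMap⁻ f y∈rest) in
      All.lookup fresh (∈-map⁺ label x′∈xs) (shared (here refl) (there x′∈xs) y∈fx y∈fx′)

InRange : ℕ → ℕ → Set
InRange n x = 1 ≤ x × x ≤ n

IsPerm : ℕ → List ℕ → Set
IsPerm n π = length π ≡ n × Unique π × All (InRange n) π

range⁻ : ∀ {n x} → x ∈ range n → InRange n x
range⁻ x∈range with _ , i∈upTo , refl ← ∈-map⁻ suc x∈range = s≤s z≤n , ∈-upTo⁻ i∈upTo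

range⁺ : ∀ {n x} → InRange n x → x ∈ range n
range⁺ {x = suc i} (_ , i<n) = ∈-map⁺ suc (∈-upTo⁺ i<n)

range-unique : ∀ n → Unique (range n)
range-unique n = Unique.map⁺ suc-injective (Unique.upTo⁺ n)

length-range : ∀ n → length (range n) ≡ n
length-range n = trans (length-map suc (upTo n)) (length-applyUpTo id n)

applyUpTo-+ : ∀ (f : ℕ → A) a b → applyUpTo f (a + b) ≡ applyUpTo f a ++ applyUpTo (f ∘ (a +_)) b
applyUpTo-+ f zero    b = refl
applyUpTo-+ f (suc a) b = cong (f 0 ∷_) (applyUpTo-+ (f ∘ suc) a b)

applyUpTo-cong : ∀ {f g : ℕ → A} → (∀ i → f i ≡ g i) → ∀ n → applyUpTo f n ≡ applyUpTo g n
applyUpTo-cong f≗g zero    = refl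
applyUpTo-cong f≗g (suc n) = cong₂ _∷_ (f≗g 0) (applyUpTo-cong (f≗g ∘ suc) n)

range-+ : ∀ a b → range (a + b) ≡ range a ++ map (a +_) (range b)
range-+ a b = begin
  range (a + b)                                ≡⟨ map-upTo suc (a + b) ⟩
  applyUpTo suc (a + b)                        ≡⟨ applyUpTo-+ suc a b ⟩
  applyUpTo suc a ++ applyUpTo (suc ∘ (a +_)) b ≡⟨ cong₂ _++_ (sym (map-upTo suc a)) (shifted b) ⟩
  range a ++ map (a +_) (range b)              ∎
  where
  open ≡-Reasoning
  shifted : ∀ b → applyUpTo (suc ∘ (a +_)) b ≡ map (a +_) (range b)
  shifted b = begin
    applyUpTo (suc ∘ (a +_)) b   ≡⟨ applyUpTo-cong (λ i → sym (+-suc a i)) b ⟩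
    applyUpTo ((a +_) ∘ suc) b   ≡⟨ sym (map-applyUpTo suc (a +_) b) ⟩
    map (a +_) (applyUpTo suc b) ≡⟨ cong (map (a +_)) (sym (map-upTo suc b)) ⟩
    map (a +_) (range b)         ∎

words-complete : ∀ {xs : List ℕ} (w : List ℕ) → All (_∈ xs) w → w ∈ words xs (length w)
words-complete [] [] = here refl
words-complete {xs} (x ∷ w) (x∈xs ∷ w⊆xs) =
  ∈-concatMap⁺ (λ w → map (_∷ w) xs) (lose (words-complete w w⊆xs) (∈-map⁺ (_∷ w) x∈xs))

words-sound : ∀ {xs : List ℕ} k {w} → w ∈ words xs k → length w ≡ k × All (_∈ xs) w
words-sound zero (here refl) = refl , []
words-sound {xs} (suc k) w∈words
  with w′ , w′∈words , w∈ext ← find (∈-concatMap⁻ (λ w′ → map (_∷ w′) xs) {xs = words xs k} w∈words)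
  with x , x∈xs , refl ← ∈-map⁻ (_∷ w′) w∈ext
  with len , w′⊆xs ← words-sound k w′∈words
  = cong suc len , x∈xs ∷ w′⊆xs

words-unique : ∀ {xs : List ℕ} k → Unique xs → Unique (words xs k)
words-unique zero _ = [] ∷ []
words-unique {xs} (suc k) distinct =
  concatMap-unique id (λ w → map (_∷ w) xs) (subst Unique (sym (map-id _)) (words-unique k distinct))
    (λ _ → Unique.map⁺ ∷-injectiveˡ distinct) same-tail
  where
  same-tail : ∀ {w w′ v} → w ∈ words xs k → w′ ∈ words xs k →
    v ∈ map (_∷ w) xs → v ∈ map (_∷ w′) xs → w ≡ w′
  same-tail _ _ v∈ v∈′ with _ , _ , refl ← ∈-map⁻ _ v∈ | _ , _ , refl ← ∈-map⁻ _ v∈′ = refl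

∈-S⁺ : ∀ {n π} → IsPerm n π → π ∈ S n
∈-S⁺ {π = π} (refl , distinct , inRange) =
  ∈-filter⁺ unique? (words-complete π (All.map range⁺ inRange)) distinct

∈-S⁻ : ∀ {n π} → π ∈ S n → IsPerm n π
∈-S⁻ {n} π∈S with π∈words , distinct ← ∈-filter⁻ unique? {xs = words (range n) n} π∈S
             with len , π⊆range ← words-sound n π∈words
  = len , distinct , All.map range⁻ π⊆range

S-unique : ∀ n → Unique (S n)
S-unique n = Unique.filter⁺ unique? (words-unique n (range-unique n))

θ²-fixed : ℕ → List (List ℕ)
θ²-fixed n = filter (λ π → ≡-dec _≟_ (θ (θ π)) π) (S n)

∈-θ²-fixed⁺ : ∀ {n π} → IsPerm n π → θ (θ π) ≡ π → π ∈ θ²-fixed n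
∈-θ²-fixed⁺ isPerm fixed = ∈-filter⁺ (λ π → ≡-dec _≟_ (θ (θ π)) π) (∈-S⁺ isPerm) fixed

∈-θ²-fixed⁻ : ∀ {n π} → π ∈ θ²-fixed n → IsPerm n π × θ (θ π) ≡ π
∈-θ²-fixed⁻ {n} π∈fixed
  with π∈S , fixed ← ∈-filter⁻ (λ π → ≡-dec _≟_ (θ (θ π)) π) {xs = S n} π∈fixed
  = ∈-S⁻ π∈S , fixed

θ²-fixed-unique : ∀ n → Unique (θ²-fixed n)
θ²-fixed-unique n = Unique.filter⁺ _ (S-unique n)

module _ (f : A → A) where

  iterate-+ : ∀ x i j → iterate f x (i + j) ≡ iterate f (iterate f x i) j
  iterate-+ x zero    j = refl
  iterate-+ x (suc i) j = iterate-+ (f x) i j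

  iterate-suc : ∀ x j → iterate f x (suc j) ≡ f (iterate f x j)
  iterate-suc x zero    = refl
  iterate-suc x (suc j) = iterate-suc (f x) j

  iterate-periodic : ∀ {x P} → iterate f x P ≡ x → ∀ q → iterate f x (q * P) ≡ x
  iterate-periodic         period zero    = refl
  iterate-periodic {x} {P} period (suc q) = begin
    iterate f x (P + q * P)           ≡⟨ iterate-+ x P (q * P) ⟩
    iterate f (iterate f x P) (q * P) ≡⟨ cong (λ y → iterate f y (q * P)) period ⟩
    iterate f x (q * P)               ≡⟨ iterate-periodic period q ⟩
    x                                 ∎
    where open ≡-Reasoning

  iterate-% : ∀ {x P} .{{_ : NonZero P}} → iterate f x P ≡ x → ∀ s → iterate f x s ≡ iterate f x (s % P)
  iterate-% {x} {P} period s = begin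
    iterate f x s
      ≡⟨ cong (iterate f x) (trans (m≡m%n+[m/n]*n s P) (+-comm (s % P) _)) ⟩
    iterate f x ((s / P) * P + s % P)
      ≡⟨ iterate-+ x ((s / P) * P) (s % P) ⟩
    iterate f (iterate f x ((s / P) * P)) (s % P)
      ≡⟨ cong (λ y → iterate f y (s % P)) (iterate-periodic period (s / P)) ⟩
    iterate f x (s % P)
      ∎
    where open ≡-Reasoning

Reaches : List ℕ → ℕ → ℕ → ℕ → Set
Reaches π m F x = ∃ λ j → j < F × iterate (nth π) x j ≡ m

module _ {π : List ℕ} {m : ℕ} where

  reaches-next : ∀ {F x} → x ≢ m → Reaches π m (suc F) x → Reaches π m F (nth π x)
  reaches-next x≢m (zero  , _         , hit) = ⊥-elim (x≢m hit)
  reaches-next x≢m (suc j , s≤s j<F , hit) = j , j<F , hit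

  walk-fuel : ∀ {F x} → Reaches π m F x → ∀ k → walk π m (F + k) x ≡ walk π m F x
  walk-fuel {suc F} {x} reach k with x ≟ m
  ... | yes _    = refl
  ... | no  x≢m = cong (x ∷_) (walk-fuel (reaches-next x≢m reach) k)

  ∈-walk⁻ : ∀ {F x y} → y ∈ walk π m F x →
    ∃ λ j → iterate (nth π) x j ≡ y × (∀ t → t ≤ j → iterate (nth π) x t ≢ m)
  ∈-walk⁻ {suc F} {x} y∈walk with x ≟ m
  ∈-walk⁻ {suc F} {x} (here refl)    | no x≢m = 0 , refl , λ { zero _ → x≢m }
  ∈-walk⁻ {suc F} {x} (there y∈walk) | no x≢m with j , hit , avoids ← ∈-walk⁻ {F} y∈walk =
    suc j , hit , λ { zero _ → x≢m ; (suc t) (s≤s t≤j) → avoids t t≤j }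

  m∉walk : ∀ {F x} → m ∉ walk π m F x
  m∉walk {F} m∈walk with j , hit , avoids ← ∈-walk⁻ {F} m∈walk = avoids j ≤-refl hit

  walk-head : ∀ {F x} → Reaches π m F x → x ∈ m ∷ walk π m F x
  walk-head {suc F} {x} _ with x ≟ m
  ... | yes refl = here refl
  ... | no  _    = there (here refl)

  walk-next : ∀ {F x y} → Reaches π m F x → y ∈ walk π m F x → nth π y ∈ m ∷ walk π m F x
  walk-next {suc F} {x} reach y∈walk with x ≟ m
  walk-next {suc F} {x} reach (here refl) | no x≢m with walk-head (reaches-next x≢m reach)
  ... | here hit       = here hit
  ... | there y∈walk′ = there (there y∈walk′)
  walk-next {suc F} {x} reach (there y∈walk) | no x≢m with walk-next (reaches-next x≢m reach) y∈walk
  ... | here hit       = here hit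
  ... | there z∈walk = there (there z∈walk)

  -- Were x on the walk from π(x), its orbit would be periodic and miss m on a whole period, hence forever.
  ∉-walk-from-next : ∀ {F x} → x ≢ m → Reaches π m F (nth π x) → x ∉ walk π m F (nth π x)
  ∉-walk-from-next {F} {x} x≢m (s , _ , hit) x∈walk
    with j , back , avoids ← ∈-walk⁻ {F} x∈walk
    with suc s % suc j | m%n<n (suc s) (suc j) | iterate-% (nth π) {x} {suc j} back (suc s)
  ... | zero  | _         | hit≡ = x≢m (trans (sym hit≡) hit)
  ... | suc t | s≤s t<j | hit≡ = avoids t (<⇒≤ t<j) (trans (sym hit≡) hit)

  walk-unique : ∀ {F x} → Reaches π m F x → Unique (walk π m F x)
  walk-unique {suc F} {x} reach with x ≟ m
  ... | yes _    = []
  ... | no  x≢m = AllP.¬Any⇒All¬ (walk π m F (nth π x)) (∉-walk-from-next x≢m next) ∷ walk-unique next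
    where
    next : Reaches π m F (nth π x)
    next = reaches-next x≢m reach

nth-∈ : ∀ π {i} → 1 ≤ i → i ≤ length π → nth π i ∈ π
nth-∈ (x ∷ π) {suc zero}    _ _            = here refl
nth-∈ (x ∷ π) {suc (suc i)} _ (s≤s i<len) = there (nth-∈ π (s≤s z≤n) i<len)

nth-injective : ∀ {π i j} → Unique π → InRange (length π) i → InRange (length π) j →
  nth π i ≡ nth π j → i ≡ j
nth-injective {x ∷ π} {suc zero}    {suc zero}    _ _ _ _ = refl
nth-injective {x ∷ π} {suc zero}    {suc (suc j)} (x∉π ∷ _) _ (_ , s≤s j<len) x≡πj =
  ⊥-elim (All.lookup x∉π (nth-∈ π (s≤s z≤n) j<len) x≡πj)
nth-injective {x ∷ π} {suc (suc i)} {suc zero}    (x∉π ∷ _) (_ , s≤s i<len) _ πi≡x =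
  ⊥-elim (All.lookup x∉π (nth-∈ π (s≤s z≤n) i<len) (sym πi≡x))
nth-injective {x ∷ π} {suc (suc i)} {suc (suc j)} (_ ∷ distinct) (_ , s≤s i<len) (_ , s≤s j<len) πi≡πj =
  cong suc (nth-injective distinct (s≤s z≤n , i<len) (s≤s z≤n , j<len) πi≡πj)

keepIfBelow : ℕ → List ℕ → List ℕ
keepIfBelow m xs with All.all? (_≤? m) xs
... | yes _ = xs
... | no  _ = []

∈-keepIfBelow⁻ : ∀ {m xs y} → y ∈ keepIfBelow m xs → All (_≤ m) xs × y ∈ xs
∈-keepIfBelow⁻ {m} {xs} y∈kept with All.all? (_≤? m) xs
... | yes xs≤m = xs≤m , y∈kept

∈-keepIfBelow⁺ : ∀ {m xs y} → All (_≤ m) xs → y ∈ xs → y ∈ keepIfBelow m xs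
∈-keepIfBelow⁺ {m} {xs} xs≤m y∈xs with All.all? (_≤? m) xs
... | yes _    = y∈xs
... | no  xs≰m = ⊥-elim (xs≰m xs≤m)

keepIfBelow-unique : ∀ {m xs} → Unique xs → Unique (keepIfBelow m xs)
keepIfBelow-unique {m} {xs} distinct with All.all? (_≤? m) xs
... | yes _ = distinct
... | no  _ = []

cycleIfMax : List ℕ → ℕ → List ℕ
cycleIfMax π m = keepIfBelow m (cycleFrom π m)

-- θ selects cycles through a function local to its definition, reachable only by unfolding θ.
θ-as-concatMap : ∀ π → θ π ≡ concatMap (cycleIfMax π) (range (length π))
θ-as-concatMap π = trans (proj₂ unfolded) (concatMap-cong selects (range (length π)))
  where
  unfolded : ∃ λ select → θ π ≡ concatMap select (range (length π))
  unfolded = _ , refl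
  selects : ∀ m → proj₁ unfolded m ≡ cycleIfMax π m
  selects m with All.all? (_≤? m) (cycleFrom π m)
  ... | yes _ = refl
  ... | no  _ = refl

module Cycles {n : ℕ} {π : List ℕ} (isPerm : IsPerm n π) where

  private
    len : length π ≡ n
    len = proj₁ isPerm

    entries-inRange : All (InRange n) π
    entries-inRange = proj₂ (proj₂ isPerm)

    inRange-len : ∀ {x} → InRange n x → InRange (length π) x
    inRange-len = subst (λ k → InRange k _) (sym len)

    range-inRange : ∀ {x} → x ∈ range (length π) → InRange n x
    range-inRange = subst (λ k → InRange k _) len ∘ range⁻

  nth-inRange : ∀ {x} → InRange n x → InRange n (nth π x)
  nth-inRange x∈ = All.lookup entries-inRange (nth-∈ π (proj₁ x∈) (proj₂ (inRange-len x∈)))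

  iterate-inRange : ∀ {x} j → InRange n x → InRange n (iterate (nth π) x j)
  iterate-inRange zero    x∈ = x∈
  iterate-inRange (suc j) x∈ = iterate-inRange j (nth-inRange x∈)

  iterate-cancel : ∀ {m} → InRange n m → ∀ i d →
    iterate (nth π) m i ≡ iterate (nth π) m (i + d) → m ≡ iterate (nth π) m d
  iterate-cancel m∈ zero    d same = same
  iterate-cancel {m} m∈ (suc i) d same = iterate-cancel m∈ i d
    (nth-injective (proj₁ (proj₂ isPerm))
      (inRange-len (iterate-inRange i m∈)) (inRange-len (iterate-inRange (i + d) m∈))
      (trans (sym (iterate-suc (nth π) m i)) (trans same (iterate-suc (nth π) m (i + d)))))

  private
    toFin : ∀ {x} → InRange n x → Fin n
    toFin {suc x} (_ , x<n) = fromℕ< x<n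

    toFin-injective : ∀ {x y} (x∈ : InRange n x) (y∈ : InRange n y) → toFin x∈ ≡ toFin y∈ → x ≡ y
    toFin-injective {suc x} {suc y} (_ , x<n) (_ , y<n) same =
      cong suc (trans (sym (toℕ-fromℕ< x<n)) (trans (cong toℕ same) (toℕ-fromℕ< y<n)))

  -- Pigeonhole on m, π(m), …, πⁿ(m) gives a repetition, which injectivity moves back to m.
  returns : ∀ {m} → InRange n m → Reaches π m (length π) (nth π m)
  returns {m} m∈ with i , j , i<j , same ← pigeonhole (n<1+n n) (λ i → toFin (iterate-inRange (toℕ i) m∈)) =
    repetition (toℕ i) (toℕ j) i<j (≤-pred (toℕ<n j)) (toFin-injective _ _ same)
    where
    repetition : ∀ i j → i < j → j ≤ n → iterate (nth π) m i ≡ iterate (nth π) m j →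
      Reaches π m (length π) (nth π m)
    repetition i j i<j j≤n same with k , refl ← m≤n⇒∃[o]m+o≡n i<j =
      k , subst (k <_) (sym len) (≤-trans (m≤n+m (suc k) i) (subst (_≤ n) (sym (+-suc i k)) j≤n)) ,
      sym (iterate-cancel m∈ i (suc k) (trans same (cong (iterate (nth π) m) (sym (+-suc i k)))))

  ∈-cycleFrom⁻ : ∀ {m y} → y ∈ cycleFrom π m → ∃ λ j → iterate (nth π) m j ≡ y
  ∈-cycleFrom⁻ (here refl)    = 0 , refl
  ∈-cycleFrom⁻ (there y∈walk) with j , hit , _ ← ∈-walk⁻ {F = length π} y∈walk = suc j , hit

  iterate-∈-cycleFrom : ∀ {m} → InRange n m → ∀ j → iterate (nth π) m j ∈ cycleFrom π m
  iterate-∈-cycleFrom m∈ zero = here refl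
  iterate-∈-cycleFrom {m} m∈ (suc j) with iterate-∈-cycleFrom m∈ j
  ... | here hit =
    subst (_∈ cycleFrom π m) (sym (trans (iterate-suc (nth π) m j) (cong (nth π) hit))) (walk-head (returns m∈))
  ... | there y∈walk =
    subst (_∈ cycleFrom π m) (sym (iterate-suc (nth π) m j)) (walk-next (returns m∈) y∈walk)

  cycleFrom-unique : ∀ {m} → InRange n m → Unique (cycleFrom π m)
  cycleFrom-unique {m} m∈ =
    AllP.¬Any⇒All¬ (walk π m (length π) (nth π m)) (m∉walk {F = length π}) ∷ walk-unique (returns m∈)

  cycleFrom-inRange : ∀ {m} → InRange n m → All (InRange n) (cycleFrom π m)
  cycleFrom-inRange m∈ = All.tabulate λ y∈ → let j , hit = ∈-cycleFrom⁻ y∈ in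
    subst (InRange n) hit (iterate-inRange j m∈)

  ∈-cycleFrom-trans : ∀ {x y z} → InRange n x →
    y ∈ cycleFrom π x → z ∈ cycleFrom π y → z ∈ cycleFrom π x
  ∈-cycleFrom-trans {x} x∈ y∈ z∈ with j , refl ← ∈-cycleFrom⁻ y∈ | i , refl ← ∈-cycleFrom⁻ z∈ =
    subst (_∈ cycleFrom π x) (iterate-+ (nth π) x j i) (iterate-∈-cycleFrom x∈ (j + i))

  ∈-cycleFrom-sym : ∀ {x y} → InRange n x → y ∈ cycleFrom π x → x ∈ cycleFrom π y
  ∈-cycleFrom-sym {x} x∈ y∈ with j , refl ← ∈-cycleFrom⁻ y∈ | k , _ , back ← returns x∈ =
    subst (_∈ cycleFrom π (iterate (nth π) x j)) returned (iterate-∈-cycleFrom (iterate-inRange j x∈) (j * k))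
    where
    open ≡-Reasoning
    returned : iterate (nth π) (iterate (nth π) x j) (j * k) ≡ x
    returned = begin
      iterate (nth π) (iterate (nth π) x j) (j * k) ≡⟨ sym (iterate-+ (nth π) x j (j * k)) ⟩
      iterate (nth π) x (j + j * k)                 ≡⟨ cong (iterate (nth π) x) (sym (*-suc j k)) ⟩
      iterate (nth π) x (j * suc k)                 ≡⟨ iterate-periodic (nth π) back j ⟩
      x                                             ∎

  θ-unique : Unique (θ π)
  θ-unique = subst Unique (sym (θ-as-concatMap π))
    (concatMap-unique id (cycleIfMax π) (subst Unique (sym (map-id _)) (range-unique _))
      (λ m∈ → keepIfBelow-unique (cycleFrom-unique (range-inRange m∈))) same-max)
    where
    same-max : ∀ {m m′ y} → m ∈ range (length π) → m′ ∈ range (length π) →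
      y ∈ cycleIfMax π m → y ∈ cycleIfMax π m′ → m ≡ m′
    same-max m∈ m′∈ y∈ y∈′
      with below , y∈C ← ∈-keepIfBelow⁻ y∈ | below′ , y∈C′ ← ∈-keepIfBelow⁻ y∈′ =
      ≤-antisym (All.lookup below′ (meet m′∈ m∈ y∈C′ y∈C)) (All.lookup below (meet m∈ m′∈ y∈C y∈C′))
      where
      meet : ∀ {m m′ y} → m ∈ range (length π) → m′ ∈ range (length π) →
        y ∈ cycleFrom π m → y ∈ cycleFrom π m′ → m′ ∈ cycleFrom π m
      meet m∈ m′∈ y∈C y∈C′ = ∈-cycleFrom-trans (range-inRange m∈) y∈C (∈-cycleFrom-sym (range-inRange m′∈) y∈C′)

  θ-inRange : All (InRange n) (θ π)
  θ-inRange = All.tabulate λ y∈θ →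
    let m , m∈ , y∈block = find (∈-concatMap⁻ (cycleIfMax π) (subst (_ ∈_) (θ-as-concatMap π) y∈θ))
    in All.lookup (cycleFrom-inRange (range-inRange m∈)) (proj₂ (∈-keepIfBelow⁻ y∈block))

  -- x is listed in the block of the largest element M of its cycle.
  θ-covers : ∀ {x} → InRange n x → x ∈ θ π
  θ-covers {x} x∈ = subst (x ∈_) (sym (θ-as-concatMap π))
    (∈-concatMap⁺ (cycleIfMax π) (lose (range⁺ (inRange-len M∈)) (∈-keepIfBelow⁺ cycleM≤M x∈cycleM)))
    where
    rest : List ℕ
    rest = walk π x (length π) (nth π x)
    M : ℕ
    M = max x rest
    M∈cycle : M ∈ cycleFrom π x
    M∈cycle = argmax-all id (here refl) (All.tabulate there)
    cycle≤M : All (_≤ M) (cycleFrom π x)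
    cycle≤M = ⊥≤max x rest ∷ xs≤max x rest
    M∈ : InRange n M
    M∈ = All.lookup (cycleFrom-inRange x∈) M∈cycle
    cycleM≤M : All (_≤ M) (cycleFrom π M)
    cycleM≤M = All.tabulate λ y∈ → All.lookup cycle≤M (∈-cycleFrom-trans x∈ M∈cycle y∈)
    x∈cycleM : x ∈ cycleFrom π M
    x∈cycleM = ∈-cycleFrom-sym x∈ M∈cycle

  θ-isPerm : IsPerm n (θ π)
  θ-isPerm = ≤-antisym
      (subst (length (θ π) ≤_) (length-range n) (Unique-⊆⇒length≤ θ-unique (range⁺ ∘ All.lookup θ-inRange)))
      (subst (_≤ length (θ π)) (length-range n) (Unique-⊆⇒length≤ (range-unique n) (θ-covers ∘ range⁻)))
    , θ-unique , θ-inRange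

infixr 5 _⊕_
_⊕_ : List ℕ → List ℕ → List ℕ
σ ⊕ τ = σ ++ map (length σ +_) τ

length-⊕ : ∀ σ τ → length (σ ⊕ τ) ≡ length σ + length τ
length-⊕ σ τ = trans (length-++ σ) (cong (length σ +_) (length-map (length σ +_) τ))

⊕-injectiveˡ : ∀ {σ σ′} τ → σ ⊕ τ ≡ σ′ ⊕ τ → σ ≡ σ′
⊕-injectiveˡ {σ} {σ′} τ same =
  ++-cancelʳ (map (length σ +_) τ) σ σ′ (trans same (cong (λ k → σ′ ++ map (k +_) τ) (sym same-length)))
  where
  same-length : length σ ≡ length σ′
  same-length = +-cancelʳ-≡ (length τ) (length σ) (length σ′)
    (trans (sym (length-⊕ σ τ)) (trans (cong length same) (length-⊕ σ′ τ)))

nth-++ˡ : ∀ σ ρ {x} → InRange (length σ) x → nth (σ ++ ρ) x ≡ nth σ x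
nth-++ˡ (y ∷ σ) ρ {suc zero}    _                = refl
nth-++ˡ (y ∷ σ) ρ {suc (suc x)} (_ , s≤s x<len) = nth-++ˡ σ ρ (s≤s z≤n , x<len)

nth-++ʳ : ∀ σ ρ {x} → 1 ≤ x → nth (σ ++ ρ) (length σ + x) ≡ nth ρ x
nth-++ʳ []          ρ {suc x} _ = refl
nth-++ʳ (y ∷ [])    ρ {suc x} _ = refl
nth-++ʳ (y ∷ z ∷ σ) ρ {suc x} _ = nth-++ʳ (z ∷ σ) ρ (s≤s z≤n)

nth-map : ∀ (f : ℕ → ℕ) τ {x} → InRange (length τ) x → nth (map f τ) x ≡ f (nth τ x)
nth-map f (y ∷ τ) {suc zero}    _                = refl
nth-map f (y ∷ τ) {suc (suc x)} (_ , s≤s x<len) = nth-map f τ (s≤s z≤n , x<len)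

nth-⊕ˡ : ∀ σ τ {x} → InRange (length σ) x → nth (σ ⊕ τ) x ≡ nth σ x
nth-⊕ˡ σ τ = nth-++ˡ σ (map (length σ +_) τ)

nth-⊕ʳ : ∀ σ τ {y} → InRange (length τ) y → nth (σ ⊕ τ) (length σ + y) ≡ length σ + nth τ y
nth-⊕ʳ σ τ y∈ = trans (nth-++ʳ σ (map (length σ +_) τ) (proj₁ y∈)) (nth-map (length σ +_) τ y∈)

⊕-isPerm : ∀ {a b σ τ} → IsPerm a σ → IsPerm b τ → IsPerm (a + b) (σ ⊕ τ)
⊕-isPerm {σ = σ} {τ} (refl , σ-distinct , σ-inRange) (refl , τ-distinct , τ-inRange) =
  length-⊕ σ τ ,
  Unique.++⁺ σ-distinct (Unique.map⁺ (+-cancelˡ-≡ (length σ) _ _) τ-distinct) disjoint ,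
  AllP.++⁺ (All.map (λ (1≤x , x≤a) → 1≤x , ≤-trans x≤a (m≤m+n _ _)) σ-inRange)
           (AllP.map⁺ (All.map (λ (1≤y , y≤b) → ≤-trans 1≤y (m≤n+m _ _) , +-monoʳ-≤ (length σ) y≤b)
                               τ-inRange))
  where
  disjoint : ∀ {x} → ¬ (x ∈ σ × x ∈ map (length σ +_) τ)
  disjoint (x∈σ , x∈τ) with y , y∈τ , refl ← ∈-map⁻ (length σ +_) x∈τ =
    <⇒≱ (m<m+n (length σ) (proj₁ (All.lookup τ-inRange y∈τ))) (proj₂ (All.lookup σ-inRange x∈σ))

keepIfBelow-map-+ : ∀ a m xs → keepIfBelow (a + m) (map (a +_) xs) ≡ map (a +_) (keepIfBelow m xs)
keepIfBelow-map-+ a m xs with All.all? (_≤? a + m) (map (a +_) xs) | All.all? (_≤? m) xs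
... | yes _       | yes _      = refl
... | no  _       | no  _      = refl
... | yes shifted | no  xs≰m = ⊥-elim (xs≰m (All.map (+-cancelˡ-≤ a _ _) (AllP.map⁻ shifted)))
... | no  shifted≰ | yes xs≤m = ⊥-elim (shifted≰ (AllP.map⁺ (All.map (+-monoʳ-≤ a) xs≤m)))

module DirectSum {σ τ : List ℕ} (σ-perm : IsPerm (length σ) σ) (τ-perm : IsPerm (length τ) τ) where

  private
    a b : ℕ
    a = length σ
    b = length τ

  walk-⊕ˡ : ∀ {m} F {x} → InRange a x → walk (σ ⊕ τ) m F x ≡ walk σ m F x
  walk-⊕ˡ     zero    _  = refl
  walk-⊕ˡ {m} (suc F) {x} x∈ with x ≟ m
  ... | yes _ = refl
  ... | no  _ = cong (x ∷_) (trans (cong (walk (σ ⊕ τ) m F) (nth-⊕ˡ σ τ x∈))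
                                   (walk-⊕ˡ F (Cycles.nth-inRange σ-perm x∈)))

  walk-⊕ʳ : ∀ {m} F {x} → InRange b x →
    walk (σ ⊕ τ) (a + m) F (a + x) ≡ map (a +_) (walk τ m F x)
  walk-⊕ʳ     zero    _  = refl
  walk-⊕ʳ {m} (suc F) {x} x∈ with x ≟ m | a + x ≟ a + m
  ... | yes _    | yes _         = refl
  ... | yes refl | no  a+x≢a+m = ⊥-elim (a+x≢a+m refl)
  ... | no  x≢m  | yes a+x≡a+m = ⊥-elim (x≢m (+-cancelˡ-≡ a _ _ a+x≡a+m))
  ... | no  _    | no  _         = cong (a + x ∷_) (trans (cong (walk (σ ⊕ τ) (a + m) F) (nth-⊕ʳ σ τ x∈))
                                                          (walk-⊕ʳ F (Cycles.nth-inRange τ-perm x∈)))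

  cycleFrom-⊕ˡ : ∀ {m} → InRange a m → cycleFrom (σ ⊕ τ) m ≡ cycleFrom σ m
  cycleFrom-⊕ˡ {m} m∈ = cong (m ∷_) (begin
    walk (σ ⊕ τ) m (length (σ ⊕ τ)) (nth (σ ⊕ τ) m) ≡⟨ cong₂ (walk (σ ⊕ τ) m) (length-⊕ σ τ) (nth-⊕ˡ σ τ m∈) ⟩
    walk (σ ⊕ τ) m (a + b) (nth σ m)                ≡⟨ walk-⊕ˡ (a + b) (Cycles.nth-inRange σ-perm m∈) ⟩
    walk σ m (a + b) (nth σ m)                      ≡⟨ walk-fuel (Cycles.returns σ-perm m∈) b ⟩
    walk σ m a (nth σ m)                            ∎)
    where open ≡-Reasoning

  cycleFrom-⊕ʳ : ∀ {m} → InRange b m → cycleFrom (σ ⊕ τ) (a + m) ≡ map (a +_) (cycleFrom τ m)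
  cycleFrom-⊕ʳ {m} m∈ = cong (a + m ∷_) (begin
    walk (σ ⊕ τ) (a + m) (length (σ ⊕ τ)) (nth (σ ⊕ τ) (a + m))
      ≡⟨ cong₂ (walk (σ ⊕ τ) (a + m)) (trans (length-⊕ σ τ) (+-comm a b)) (nth-⊕ʳ σ τ m∈) ⟩
    walk (σ ⊕ τ) (a + m) (b + a) (a + nth τ m)
      ≡⟨ walk-⊕ʳ (b + a) (Cycles.nth-inRange τ-perm m∈) ⟩
    map (a +_) (walk τ m (b + a) (nth τ m))
      ≡⟨ cong (map (a +_)) (walk-fuel (Cycles.returns τ-perm m∈) a) ⟩
    map (a +_) (walk τ m b (nth τ m))
      ∎)
    where open ≡-Reasoning

  cycleIfMax-⊕ˡ : ∀ {m} → InRange a m → cycleIfMax (σ ⊕ τ) m ≡ cycleIfMax σ m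
  cycleIfMax-⊕ˡ {m} m∈ = cong (keepIfBelow m) (cycleFrom-⊕ˡ m∈)

  cycleIfMax-⊕ʳ : ∀ {m} → InRange b m → cycleIfMax (σ ⊕ τ) (a + m) ≡ map (a +_) (cycleIfMax τ m)
  cycleIfMax-⊕ʳ {m} m∈ =
    trans (cong (keepIfBelow (a + m)) (cycleFrom-⊕ʳ m∈)) (keepIfBelow-map-+ a m (cycleFrom τ m))

  θ-⊕ : θ (σ ⊕ τ) ≡ θ σ ⊕ θ τ
  θ-⊕ = begin
    θ (σ ⊕ τ)
      ≡⟨ θ-as-concatMap (σ ⊕ τ) ⟩
    concatMap (cycleIfMax (σ ⊕ τ)) (range (length (σ ⊕ τ)))
      ≡⟨ cong (concatMap (cycleIfMax (σ ⊕ τ))) (trans (cong range (length-⊕ σ τ)) (range-+ a b)) ⟩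
    concatMap (cycleIfMax (σ ⊕ τ)) (range a ++ map (a +_) (range b))
      ≡⟨ concatMap-++ (cycleIfMax (σ ⊕ τ)) (range a) (map (a +_) (range b)) ⟩
    concatMap (cycleIfMax (σ ⊕ τ)) (range a) ++ concatMap (cycleIfMax (σ ⊕ τ)) (map (a +_) (range b))
      ≡⟨ cong (concatMap (cycleIfMax (σ ⊕ τ)) (range a) ++_)
              (concatMap-map (cycleIfMax (σ ⊕ τ)) (a +_) (range b)) ⟩
    concatMap (cycleIfMax (σ ⊕ τ)) (range a) ++ concatMap (cycleIfMax (σ ⊕ τ) ∘ (a +_)) (range b)
      ≡⟨ cong₂ _++_ (cong concat (map-cong-local (All.tabulate (cycleIfMax-⊕ˡ ∘ range⁻))))
                    (cong concat (map-cong-local (All.tabulate (cycleIfMax-⊕ʳ ∘ range⁻)))) ⟩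
    concatMap (cycleIfMax σ) (range a) ++ concatMap (map (a +_) ∘ cycleIfMax τ) (range b)
      ≡⟨ cong (concatMap (cycleIfMax σ) (range a) ++_) (sym (map-concatMap (a +_) (cycleIfMax τ) (range b))) ⟩
    concatMap (cycleIfMax σ) (range a) ++ map (a +_) (concatMap (cycleIfMax τ) (range b))
      ≡⟨ cong₂ (λ ρ ρ′ → ρ ++ map (a +_) ρ′) (sym (θ-as-concatMap σ)) (sym (θ-as-concatMap τ)) ⟩
    θ σ ++ map (a +_) (θ τ)
      ≡⟨ cong (λ k → θ σ ++ map (k +_) (θ τ)) (sym (proj₁ (Cycles.θ-isPerm σ-perm))) ⟩
    θ σ ⊕ θ τ
      ∎
    where open ≡-Reasoning

θ-⊕ : ∀ {a b σ τ} → IsPerm a σ → IsPerm b τ → θ (σ ⊕ τ) ≡ θ σ ⊕ θ τ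
θ-⊕ σ-perm@(refl , _) τ-perm@(refl , _) = DirectSum.θ-⊕ σ-perm τ-perm

θ²-⊕ : ∀ {a b σ τ} → IsPerm a σ → IsPerm b τ → θ (θ (σ ⊕ τ)) ≡ θ (θ σ) ⊕ θ (θ τ)
θ²-⊕ σ-perm τ-perm =
  trans (cong θ (θ-⊕ σ-perm τ-perm)) (θ-⊕ (Cycles.θ-isPerm σ-perm) (Cycles.θ-isPerm τ-perm))

deficit : List ℕ → ℕ
deficit τ = length τ ∸ nth τ (length τ)

deficit-⊕ : ∀ σ τ → 1 ≤ length τ →
  (length σ + length τ) ∸ nth (σ ⊕ τ) (length σ + length τ) ≡ deficit τ
deficit-⊕ σ τ 1≤k = trans (cong (length σ + length τ ∸_) (nth-⊕ʳ σ τ (1≤k , ≤-refl)))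
                          ([m+n]∸[m+o]≡n∸o (length σ) (length τ) (nth τ (length τ)))

IsBlock : List ℕ → Set
IsBlock τ = 1 ≤ length τ × IsPerm (length τ) τ × θ (θ τ) ≡ τ

isBlock? : ∀ τ → Dec (IsBlock τ)
isBlock? τ = 1 ≤? length τ
        ×-dec (length τ ≟ length τ ×-dec unique? τ ×-dec All.all? (λ x → 1 ≤? x ×-dec x ≤? length τ) τ)
        ×-dec ≡-dec _≟_ (θ (θ τ)) τ

extensions : ℕ → List ℕ → List (List ℕ)
extensions n τ = map (_⊕ τ) (θ²-fixed (n ∸ length τ))

length-extensions : ∀ n τ → length (extensions n τ) ≡ f² (n ∸ length τ)
length-extensions n τ = length-map (_⊕ τ) (θ²-fixed (n ∸ length τ))

extensions-unique : ∀ n τ → Unique (extensions n τ)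
extensions-unique n τ = Unique.map⁺ (⊕-injectiveˡ τ) (θ²-fixed-unique (n ∸ length τ))

module _ {n τ} (block : IsBlock τ) (k≤n : length τ ≤ n) where

  private
    τ-perm : IsPerm (length τ) τ
    τ-perm = proj₁ (proj₂ block)

    ∈-extensions⁻ : ∀ {π} → π ∈ extensions n τ →
      ∃ λ σ → π ≡ σ ⊕ τ × IsPerm (n ∸ length τ) σ × θ (θ σ) ≡ σ × length σ + length τ ≡ n
    ∈-extensions⁻ π∈ with σ , σ∈ , refl ← ∈-map⁻ (_⊕ τ) π∈ with σ-perm , σ-fixed ← ∈-θ²-fixed⁻ σ∈ =
      σ , refl , σ-perm , σ-fixed , trans (cong (_+ length τ) (proj₁ σ-perm)) (m∸n+n≡m k≤n)

  extensions-⊆ : extensions n τ ⊆ θ²-fixed n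
  extensions-⊆ π∈ with σ , refl , σ-perm , σ-fixed , _ ← ∈-extensions⁻ π∈ =
    ∈-θ²-fixed⁺ (subst (λ k → IsPerm k (σ ⊕ τ)) (m∸n+n≡m k≤n) (⊕-isPerm σ-perm τ-perm))
                (trans (θ²-⊕ σ-perm τ-perm) (cong₂ _⊕_ σ-fixed (proj₂ (proj₂ block))))

  deficit-extensions : ∀ {π} → π ∈ extensions n τ → n ∸ nth π n ≡ deficit τ
  deficit-extensions π∈ with σ , refl , _ , _ , refl ← ∈-extensions⁻ π∈ = deficit-⊕ σ τ (proj₁ block)

length-concatMap : ∀ (f : A → List B) xs → length (concatMap f xs) ≡ sum (map (length ∘ f) xs)
length-concatMap f []       = refl
length-concatMap f (x ∷ xs) = trans (length-++ (f x)) (cong (length (f x) +_) (length-concatMap f xs))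

sum-f²-≤ : ∀ n τs → All IsBlock τs → All (λ τ → length τ ≤ n) τs → Unique (map deficit τs) →
  sum (map (λ τ → f² (n ∸ length τ)) τs) ≤ f² n
sum-f²-≤ n τs blocks fits distinct = begin
  sum (map (λ τ → f² (n ∸ length τ)) τs)    ≡⟨ cong sum (map-cong (λ τ → sym (length-extensions n τ)) τs) ⟩
  sum (map (length ∘ extensions n) τs)      ≡⟨ sym (length-concatMap (extensions n) τs) ⟩
  length (concatMap (extensions n) τs)      ≤⟨ Unique-⊆⇒length≤ unique sub ⟩
  f² n                                      ∎
  where
  open ≤-Reasoning
  block : ∀ {τ} → τ ∈ τs → IsBlock τ
  block = All.lookup blocks
  fit : ∀ {τ} → τ ∈ τs → length τ ≤ n
  fit = All.lookup fits
  unique : Unique (concatMap (extensions n) τs)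
  unique = concatMap-unique deficit (extensions n) distinct (λ _ → extensions-unique n _)
    λ τ∈ τ′∈ π∈ π∈′ → trans (sym (deficit-extensions (block τ∈) (fit τ∈) π∈))
                            (deficit-extensions (block τ′∈) (fit τ′∈) π∈′)
  sub : concatMap (extensions n) τs ⊆ θ²-fixed n
  sub π∈ with τ , τ∈ , π∈ext ← find (∈-concatMap⁻ (extensions n) π∈) =
    extensions-⊆ (block τ∈) (fit τ∈) π∈ext

blocks : List (List ℕ)
blocks = (1 ∷ [])
       ∷ (2 ∷ 1 ∷ [])
       ∷ (3 ∷ 4 ∷ 2 ∷ 1 ∷ [])
       ∷ (4 ∷ 1 ∷ 3 ∷ 2 ∷ [])
       ∷ (6 ∷ 3 ∷ 7 ∷ 9 ∷ 4 ∷ 8 ∷ 5 ∷ 2 ∷ 1 ∷ [])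
       ∷ (9 ∷ 1 ∷ 6 ∷ 8 ∷ 2 ∷ 3 ∷ 7 ∷ 5 ∷ 4 ∷ [])
       ∷ []

proposition6p2 : (n : ℕ) → 9 < n →
    f² (n ∸ 1) + f² (n ∸ 2) + 2 * f² (n ∸ 4) + 2 * f² (n ∸ 9) ≤ f² n
proposition6p2 n 9<n = begin
  f² (n ∸ 1) + f² (n ∸ 2) + 2 * f² (n ∸ 4) + 2 * f² (n ∸ 9)
    ≡⟨ regroup (f² (n ∸ 1)) (f² (n ∸ 2)) (f² (n ∸ 4)) (f² (n ∸ 9)) ⟩
  sum (map (λ τ → f² (n ∸ length τ)) blocks)
    ≤⟨ sum-f²-≤ n blocks (from-yes (All.all? isBlock? blocks)) fit (from-yes (unique? (map deficit blocks))) ⟩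
  f² n
    ∎
  where
  open ≤-Reasoning
  regroup : ∀ a b c d → a + b + 2 * c + 2 * d ≡ a + (b + (c + (c + (d + (d + 0)))))
  regroup = solve-∀
  fit : All (λ τ → length τ ≤ n) blocks
  fit = All.map (λ k≤9 → ≤-trans k≤9 (<⇒≤ 9<n)) (from-yes (All.all? (λ τ → length τ ≤? 9) blocks))
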